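{- Let $G$ be a $\Gamma$-vertex-transitive graph, where $\Gamma$ is a subgroup of $\mathrm{Aut}(G)$, let $u$ be a vertex of $G$ and $\alpha\in\Gamma$. If $\alpha(u)$ is a neighbor of $u$ in $G$, then the number of distinct neighbors of $u$ in $G_{u,\alpha}$ is $|\Gamma_u:\Gamma_u\cap\alpha\Gamma_u\alpha^{ -1}|$ if $\alpha^{ -1}\in\Gamma_u\alpha\Gamma_u$, and $2|\Gamma_u:\Gamma_u\cap\alpha\Gamma_u\alpha^{ -1}|$ if $\alpha^{ -1}\notin\Gamma_u\alpha\Gamma_u$.
   Context: Graphs are finite, undirected, with parallel edges allowed; vertex-transitive graphs have no loops. $\mathrm{Aut}(G)$ consists of incidence-preserving bijections of $V(G)\cup E(G)$ mapping vertices to vertices and edges to edges. $G$ is $\Gamma$-vertex-transitive if $\Gamma\le\mathrm{Aut}(G)$ is transitive on $V(G)$; $\Gamma_u$ is the stabilizer of $u$ in $\Gamma$. For a vertex $u$ and $\alpha\in\Gamma$, $G_{u,\alpha}$ is the spanning subgraph of $G$ whose edges are all edges of $G$ joining $\gamma(u)$ and $(\gamma\beta\alpha)(u)$ for some $\gamma\in\Gamma$ and $\beta\in\Gamma_u$. -}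

module Defs where

open import Data.Nat using (ℕ)
open import Data.Fin using (Fin)
open import Data.Product using (_×_; _,_; proj₁; proj₂; ∃; Σ)
open import Data.Sum using (_⊎_)
open import Relation.Binary.PropositionalEquality using (_≡_)
open import Relation.Nullary using (¬_)
open import Function.Definitions using (Bijective)

-- A finite multigraph: vertices Fin nV, edges Fin nE, each edge has two
-- endpoints (stored as an ordered pair but read as an unordered pair).
record Graph : Set where
  field
    nV nE : ℕ
    ends : Fin nE → Fin nV × Fin nV

record HasSize {A : Set} (_≈_ : A → A → Set) (P : A → Set) (k : ℕ) : Set where
  field
    elems    : Fin k → A
    inP      : ∀ i → P (elems i)
    distinct : ∀ i j → elems i ≈ elems j → i ≡ j
    complete : ∀ a → P a → ∃ λ i → elems i ≈ a

module _ (G : Graph) where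
  open Graph G

  Joins : Fin nE → Fin nV → Fin nV → Set
  Joins e x y = (ends e ≡ (x , y)) ⊎ (ends e ≡ (y , x))

  Loopless : Set
  Loopless = ∀ e → ¬ (proj₁ (ends e) ≡ proj₂ (ends e))

  record Aut : Set where
    field
      vmap : Fin nV → Fin nV
      emap : Fin nE → Fin nE
      vbij : Bijective _≡_ _≡_ vmap
      ebij : Bijective _≡_ _≡_ emap
      inc  : ∀ e → Joins (emap e) (vmap (proj₁ (ends e))) (vmap (proj₂ (ends e)))
  open Aut public

  _≈ₐ_ : Aut → Aut → Set
  g ≈ₐ h = (∀ x → vmap g x ≡ vmap h x) × (∀ e → emap g e ≡ emap h e)

  IsComp : Aut → Aut → Aut → Set
  IsComp k g h = (∀ x → vmap k x ≡ vmap g (vmap h x)) × (∀ e → emap k e ≡ emap g (emap h e))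

  IsId : Aut → Set
  IsId k = (∀ x → vmap k x ≡ x) × (∀ e → emap k e ≡ e)

  IsLeftInv : Aut → Aut → Set
  IsLeftInv h g = (∀ x → vmap h (vmap g x) ≡ x) × (∀ e → emap h (emap g e) ≡ e)

  -- a (necessarily finite) subgroup Γ ≤ Aut(G), given by an enumeration
  -- of its elements (repetitions allowed)
  record Subgroup : Set where
    field
      N    : ℕ
      elt  : Fin N → Aut
      id∈  : ∃ λ i → IsId (elt i)
      comp∈ : ∀ i j → ∃ λ k → IsComp (elt k) (elt i) (elt j)
      inv∈ : ∀ i → ∃ λ j → IsLeftInv (elt j) (elt i)

module _ {G : Graph} (Γ : Subgroup G) where
  open Graph G
  open Subgroup Γ

  _∈Γ : Aut G → Set
  g ∈Γ = ∃ λ i → _≈ₐ_ G (elt i) g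

  VertexTransitive : Set
  VertexTransitive = ∀ x y → ∃ λ g → g ∈Γ × (vmap g x ≡ y)

  Stab : Fin nV → Aut G → Set
  Stab u g = g ∈Γ × (vmap g u ≡ u)

  -- g ∈ α Γ_u α⁻¹, i.e. g = α β α⁻¹ (g ∘ α = α ∘ β) for some β ∈ Γ_u
  InConj : Fin nV → Aut G → Aut G → Set
  InConj u α g = ∃ λ β → Stab u β
    × (∀ x → vmap g (vmap α x) ≡ vmap α (vmap β x))
    × (∀ e → emap g (emap α e) ≡ emap α (emap β e))

  StabCap : Fin nV → Aut G → Aut G → Set
  StabCap u α g = Stab u g × InConj u α g

  -- α⁻¹ ∈ Γ_u α Γ_u, i.e. β₁ α β₂ = α⁻¹ (β₁ ∘ α ∘ β₂ ∘ α = id) for some β₁, β₂ ∈ Γ_u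
  InvInDoubleCoset : Fin nV → Aut G → Set
  InvInDoubleCoset u α = ∃ λ β₁ → ∃ λ β₂ → Stab u β₁ × Stab u β₂
    × (∀ x → vmap β₁ (vmap α (vmap β₂ (vmap α x))) ≡ x)
    × (∀ e → emap β₁ (emap α (emap β₂ (emap α e))) ≡ e)

  EdgeOfGuα : Fin nV → Aut G → Fin nE → Set
  EdgeOfGuα u α e = ∃ λ γ → ∃ λ β → γ ∈Γ × Stab u β
    × Joins G e (vmap γ u) (vmap γ (vmap β (vmap α u)))

  NbrGuα : Fin nV → Aut G → Fin nV → Set
  NbrGuα u α v = ∃ λ e → EdgeOfGuα u α e × Joins G e u v

{-# OPTIONS --safe #-}
-- Let a = α u and a′ = α⁻¹ u. An edge γu — γβa of G_{u,α} (γ ∈ Γ, β ∈ Γ_u) through u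
-- either has γu = u, and then its other end is γβ·a, or γβa = u, and then γβα ∈ Γ_u and its
-- other end is γβα·a′; conversely the images of the edge u — a under Γ_u and Γ_u α⁻¹ reach
-- every point of Γ_u·a and Γ_u·a′. So the neighbours of u form Γ_u·a ∪ Γ_u·a′, and these
-- orbits coincide if α⁻¹ ∈ Γ_u α Γ_u and are disjoint otherwise. The fibres of g ↦ g·a on Γ_u
-- are cosets of Γ_{u,a} = Γ_u ∩ αΓ_uα⁻¹, and Γ_{u,a′} is conjugate to Γ_{u,a} by α⁻¹, so every
-- fibre has c elements. Counting Γ_u (respectively {a, a′} × Γ_u) fibre by fibre over the k
-- neighbours gives kc = h (respectively kc = 2h).

module Submission where

open import Level using (0ℓ)
open import Data.Fin using (Fin; zero; suc; combine; remQuot)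
open import Data.Fin.Properties using (injective⇒≤; remQuot-combine; *↔×)
open import Data.Nat using (ℕ; _*_; _≤_)
open import Data.Nat.Properties using (≤-antisym)
open import Data.Product using (_×_; _,_; proj₁; proj₂; ∃; swap)
open import Data.Product.Properties using (,-injective)
open import Data.Product.Relation.Binary.Pointwise.NonDependent using (_×ₛ_)
open import Data.Sum using (_⊎_; inj₁; inj₂)
open import Data.Unit using (⊤; tt)
open import Function.Base using (_∘_; id)
open import Function.Bundles using (Injection)
open import Function.Construct.Composition using (bijective; injection)
open import Function.Definitions using (Surjective)
open import Function.Properties.Inverse using (↔⇒↣)
open import Relation.Binary.Bundles using (Setoid)
open import Relation.Binary.PropositionalEquality as ≡ using (_≡_; refl; cong; subst; subst₂)
open import Relation.Nullary using (¬_; contradiction)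

open import Defs

module _ (S : Setoid 0ℓ 0ℓ) where
  open Setoid S using (_≈_; sym; trans; reflexive) renaming (Carrier to A)

  HasSize-≤ : ∀ {P m n} → HasSize _≈_ P m → HasSize _≈_ P n → m ≤ n
  HasSize-≤ {m = m} {n} X Y = injective⇒≤ index-injective
    where
    module X = HasSize X
    module Y = HasSize Y
    index : Fin m → Fin n
    index i = proj₁ (Y.complete (X.elems i) (X.inP i))
    index-≈ : ∀ i → Y.elems (index i) ≈ X.elems i
    index-≈ i = proj₂ (Y.complete (X.elems i) (X.inP i))
    index-injective : ∀ {i j} → index i ≡ index j → i ≡ j
    index-injective {i} {j} eq =
      X.distinct i j (trans (sym (index-≈ i)) (trans (reflexive (cong Y.elems eq)) (index-≈ j)))

  HasSize-unique : ∀ {P m n} → HasSize _≈_ P m → HasSize _≈_ P n → m ≡ n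
  HasSize-unique X Y = ≤-antisym (HasSize-≤ X Y) (HasSize-≤ Y X)

  HasSize-⇔ : ∀ {P Q : A → Set} {n} → (∀ a → P a → Q a) → (∀ a → Q a → P a)
    → HasSize _≈_ P n → HasSize _≈_ Q n
  HasSize-⇔ P⇒Q Q⇒P X = record
    { elems    = elems
    ; inP      = λ i → P⇒Q _ (inP i)
    ; distinct = distinct
    ; complete = λ a q → complete a (Q⇒P a q)
    }
    where open HasSize X

  HasSize-fibres : ∀ {B : Set} {P : A → Set} {Q : B → Set} {k c} (f : A → B)
    → (∀ {a a′} → a ≈ a′ → f a ≡ f a′)
    → (∀ a → P a → Q (f a))
    → HasSize _≡_ Q k
    → (∀ b → Q b → HasSize _≈_ (λ a → P a × f a ≡ b) c)
    → HasSize _≈_ P (k * c)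
  HasSize-fibres {P = P} {k = k} {c} f f-cong P⇒Q Qₖ fibre = record
    { elems    = elems ∘ split
    ; inP      = λ x → let (i , j) = split x in proj₁ (Fibre.inP i j)
    ; distinct = λ x y eq → Injection.injective (↔⇒↣ *↔×) (elems-distinct (split x) (split y) eq)
    ; complete = complete
    }
    where
    module Q = HasSize Qₖ
    module Fibre i = HasSize (fibre (Q.elems i) (Q.inP i))
    split : Fin (k * c) → Fin k × Fin c
    split = remQuot {k} c
    elems : Fin k × Fin c → A
    elems (i , j) = Fibre.elems i j
    elems-distinct : ∀ p q → elems p ≈ elems q → p ≡ q
    elems-distinct (i , j) (i′ , j′) eq
      with refl ← Q.distinct i i′ (≡.trans (≡.sym (proj₂ (Fibre.inP i j)))
                                    (≡.trans (f-cong eq) (proj₂ (Fibre.inP i′ j′))))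
      = cong (i ,_) (Fibre.distinct i j j′ eq)
    complete : ∀ a → P a → ∃ λ x → elems (split x) ≈ a
    complete a p =
      let (i , fa≡Qi) = Q.complete (f a) (P⇒Q a p)
          (j , ≈a)    = Fibre.complete i a (p , ≡.sym fa≡Qi)
      in combine i j , subst (λ q → elems q ≈ a) (≡.sym (remQuot-combine i j)) ≈a

module _ (S T : Setoid 0ℓ 0ℓ) where
  open Setoid S using () renaming (Carrier to A; _≈_ to _≈₁_)
  open Setoid T using () renaming (Carrier to B; _≈_ to _≈₂_; trans to ≈₂-trans)

  HasSize-map : ∀ {P : A → Set} {Q : B → Set} {n} (φ : Injection S T)
    → (∀ a → P a → Q (Injection.to φ a))
    → (∀ b → Q b → ∃ λ a → P a × Injection.to φ a ≈₂ b)
    → HasSize _≈₁_ P n → HasSize _≈₂_ Q n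
  HasSize-map φ P⇒Q onto X = record
    { elems    = λ i → to (elems i)
    ; inP      = λ i → P⇒Q _ (inP i)
    ; distinct = λ i j eq → distinct i j (injective eq)
    ; complete = λ b q →
        let (a , p , φa≈b) = onto b q
            (i , ≈a)       = complete a p
        in i , ≈₂-trans (φ-cong ≈a) φa≈b
    }
    where
    open HasSize X
    open Injection φ using (to; injective) renaming (cong to φ-cong)

HasSize-Fin : ∀ n → HasSize _≡_ (λ (_ : Fin n) → ⊤) n
HasSize-Fin n = record
  { elems    = λ i → i
  ; inP      = _
  ; distinct = λ _ _ eq → eq
  ; complete = λ i _ → i , refl
  }

module _ (S : Setoid 0ℓ 0ℓ) where
  open Setoid S renaming (Carrier to A; refl to ≈-refl)

  HasSize-× : ∀ {B : Set} {Q : B → Set} {P : A → Set} {m n}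
    → HasSize _≡_ Q m → HasSize _≈_ P n
    → HasSize (Setoid._≈_ (≡.setoid B ×ₛ S)) (λ (b , a) → Q b × P a) (m * n)
  HasSize-× {B} {Q} {P} {n = n} Qₘ Pₙ = HasSize-fibres B×S proj₁ proj₁ (λ _ → proj₁) Qₘ fibre
    where
    B×S = ≡.setoid B ×ₛ S
    fibre : ∀ b → Q b → HasSize (Setoid._≈_ B×S) (λ (b′ , a) → (Q b′ × P a) × b′ ≡ b) n
    fibre b q = HasSize-map S B×S (record { to = b ,_ ; cong = refl ,_ ; injective = proj₂ })
      (λ a p → (q , p) , refl)
      (λ { (_ , a) ((_ , p) , refl) → a , p , refl , ≈-refl })
      Pₙ

module _ {A B : Set} {f : A → B} (f-surjective : Surjective _≡_ _≡_ f) where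

  surjective-cancelʳ : ∀ {C : Set} {h h′ : B → C} → (∀ x → h (f x) ≡ h′ (f x)) → ∀ y → h y ≡ h′ y
  surjective-cancelʳ {h = h} {h′} eq y =
    let (x , fx≡y) = f-surjective y in subst (λ z → h z ≡ h′ z) (fx≡y refl) (eq x)

  surjective-inverseʳ : ∀ {g : B → A} → (∀ x → g (f x) ≡ x) → ∀ y → f (g y) ≡ y
  surjective-inverseʳ {g} g∘f≗id = surjective-cancelʳ (λ x → cong f (g∘f≗id x))

module Automorphisms (G : Graph) where
  open Graph G

  infix 4 _≈_
  _≈_ : Aut G → Aut G → Set
  _≈_ = _≈ₐ_ G

  joins-sym : ∀ {e x y} → Joins G e x y → Joins G e y x
  joins-sym (inj₁ p) = inj₂ p
  joins-sym (inj₂ p) = inj₁ p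

  joins-endpoints : ∀ {e x y x′ y′} → Joins G e x y → Joins G e x′ y′
    → (x ≡ x′ × y ≡ y′) ⊎ (x ≡ y′ × y ≡ x′)
  joins-endpoints (inj₁ p) (inj₁ q) = inj₁ (,-injective (≡.trans (≡.sym p) q))
  joins-endpoints (inj₁ p) (inj₂ q) = inj₂ (,-injective (≡.trans (≡.sym p) q))
  joins-endpoints (inj₂ p) (inj₁ q) = inj₂ (swap (,-injective (≡.trans (≡.sym p) q)))
  joins-endpoints (inj₂ p) (inj₂ q) = inj₁ (swap (,-injective (≡.trans (≡.sym p) q)))

  joins-map : (g : Aut G) → ∀ {e x y} → Joins G e x y → Joins G (emap g e) (vmap g x) (vmap g y)
  joins-map g {e} J with ends e | inc g e
  joins-map g (inj₁ refl) | _ | I = I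
  joins-map g (inj₂ refl) | _ | I = joins-sym I

  idₐ : Aut G
  idₐ = record
    { vmap = id
    ; emap = id
    ; vbij = id , λ x → x , id
    ; ebij = id , λ e → e , id
    ; inc  = λ e → inj₁ refl
    }

  infixr 9 _∘ₐ_
  _∘ₐ_ : Aut G → Aut G → Aut G
  g ∘ₐ h = record
    { vmap = vmap g ∘ vmap h
    ; emap = emap g ∘ emap h
    ; vbij = bijective _≡_ _≡_ _≡_ (vbij h) (vbij g)
    ; ebij = bijective _≡_ _≡_ _≡_ (ebij h) (ebij g)
    ; inc  = joins-map g ∘ inc h
    }

  Aut-setoid : Setoid 0ℓ 0ℓ
  Aut-setoid = record
    { Carrier       = Aut G
    ; _≈_           = _≈_
    ; isEquivalence = record
      { refl  = (λ _ → refl) , (λ _ → refl)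
      ; sym   = λ (v , e) → ≡.sym ∘ v , ≡.sym ∘ e
      ; trans = λ (v , e) (v′ , e′) → (λ x → ≡.trans (v x) (v′ x)) , (λ x → ≡.trans (e x) (e′ x))
      }
    }

  left-translation : Aut G → Injection Aut-setoid Aut-setoid
  left-translation g = record
    { to        = g ∘ₐ_
    ; cong      = λ (v , e) → cong (vmap g) ∘ v , cong (emap g) ∘ e
    ; injective = λ (v , e) → proj₁ (vbij g) ∘ v , proj₁ (ebij g) ∘ e
    }

  right-translation : Aut G → Injection Aut-setoid Aut-setoid
  right-translation g = record
    { to        = _∘ₐ g
    ; cong      = λ (v , e) → v ∘ vmap g , e ∘ emap g
    ; injective = λ (v , e) →
        surjective-cancelʳ (proj₂ (vbij g)) v , surjective-cancelʳ (proj₂ (ebij g)) e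
    }

  leftInv⇒rightInv : ∀ {g h} → IsLeftInv G h g → IsLeftInv G g h
  leftInv⇒rightInv {g} (v , e) =
    surjective-inverseʳ (proj₂ (vbij g)) v , surjective-inverseʳ (proj₂ (ebij g)) e

module _ {G : Graph} (Γ : Subgroup G) where
  open Graph G
  open Subgroup Γ
  open Automorphisms G

  ∘ₐ-∈Γ : ∀ g h → _∈Γ Γ g → _∈Γ Γ h → _∈Γ Γ (g ∘ₐ h)
  ∘ₐ-∈Γ g h (i , gv , ge) (j , hv , he) =
    let (k , kv , ke) = comp∈ i j
    in k , (λ x → ≡.trans (kv x) (≡.trans (gv _) (cong (vmap g) (hv x))))
         , (λ e → ≡.trans (ke e) (≡.trans (ge _) (cong (emap g) (he e))))

  inverse : ∀ g → _∈Γ Γ g → Aut G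
  inverse _ (i , _) = elt (proj₁ (inv∈ i))

  inverse-∈Γ : ∀ g (p : _∈Γ Γ g) → _∈Γ Γ (inverse g p)
  inverse-∈Γ _ (i , _) = proj₁ (inv∈ i) , (λ _ → refl) , (λ _ → refl)

  inverseˡ : ∀ g (p : _∈Γ Γ g) → IsLeftInv G (inverse g p) g
  inverseˡ g p@(i , gv , ge) =
    let (_ , v , e) = inv∈ i
    in (λ x → ≡.trans (cong (vmap (inverse g p)) (≡.sym (gv x))) (v x))
     , (λ x → ≡.trans (cong (emap (inverse g p)) (≡.sym (ge x))) (e x))

  inverseʳ : ∀ g (p : _∈Γ Γ g) → IsLeftInv G g (inverse g p)
  inverseʳ g p = leftInv⇒rightInv {g = g} {inverse g p} (inverseˡ g p)

  inverse-maps-back : ∀ g (p : _∈Γ Γ g) {x y} → vmap g x ≡ y → vmap (inverse g p) y ≡ x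
  inverse-maps-back g p {x} gx≡y =
    ≡.trans (cong (vmap (inverse g p)) (≡.sym gx≡y)) (proj₁ (inverseˡ g p) x)

  Stab-id : ∀ {x} → Stab Γ x idₐ
  Stab-id = id∈ , refl

  Stab-∘ : ∀ {x} g h → Stab Γ x g → Stab Γ x h → Stab Γ x (g ∘ₐ h)
  Stab-∘ g h (gΓ , gx≡x) (hΓ , hx≡x) = ∘ₐ-∈Γ g h gΓ hΓ , ≡.trans (cong (vmap g) hx≡x) gx≡x

  Stab-inverse : ∀ {x} g (s : Stab Γ x g) → Stab Γ x (inverse g (proj₁ s))
  Stab-inverse g (gΓ , gx≡x) = inverse-∈Γ g gΓ , inverse-maps-back g gΓ gx≡x

  Stab₂ : Fin nV → Fin nV → Aut G → Set
  Stab₂ x y g = Stab Γ x g × vmap g y ≡ y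

  Stab₂-sym : ∀ {x y} g → Stab₂ x y g → Stab₂ y x g
  Stab₂-sym _ ((gΓ , gx≡x) , gy≡y) = (gΓ , gy≡y) , gx≡x

  Orbit : Fin nV → Fin nV → Fin nV → Set
  Orbit x y v = ∃ λ g → Stab Γ x g × vmap g y ≡ v

  -- The fibre over v = g₀ y of g ↦ g y on Γ_x is the coset g₀ Γ_{x,y}.
  orbit-fibre-size : ∀ {x y v c} → Orbit x y v → HasSize _≈_ (Stab₂ x y) c
    → HasSize _≈_ (λ g → Stab Γ x g × vmap g y ≡ v) c
  orbit-fibre-size {x} {y} {v} (g₀ , s₀ , g₀y≡v) =
    HasSize-map Aut-setoid Aut-setoid (left-translation g₀) into onto
    where
    g₀Γ = proj₁ s₀
    g₀⁻¹ = inverse g₀ g₀Γ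
    into : ∀ t → Stab₂ x y t → Stab Γ x (g₀ ∘ₐ t) × vmap g₀ (vmap t y) ≡ v
    into t (st , ty≡y) = Stab-∘ g₀ t s₀ st , ≡.trans (cong (vmap g₀) ty≡y) g₀y≡v
    onto : ∀ g → Stab Γ x g × vmap g y ≡ v → ∃ λ t → Stab₂ x y t × g₀ ∘ₐ t ≈ g
    onto g (sg , gy≡v) = g₀⁻¹ ∘ₐ g
      , (Stab-∘ g₀⁻¹ g (Stab-inverse g₀ s₀) sg , inverse-maps-back g₀ g₀Γ (≡.trans g₀y≡v (≡.sym gy≡v)))
      , proj₁ (inverseʳ g₀ g₀Γ) ∘ vmap g , proj₂ (inverseʳ g₀ g₀Γ) ∘ emap g

  Stab₂-conjugate : ∀ {x y c} g (p : _∈Γ Γ g) → HasSize _≈_ (Stab₂ x y) c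
    → HasSize _≈_ (Stab₂ (vmap g x) (vmap g y)) c
  Stab₂-conjugate {x} {y} g p = HasSize-map Aut-setoid Aut-setoid conjugation into onto
    where
    g⁻¹ = inverse g p
    conjugation : Injection Aut-setoid Aut-setoid
    conjugation = injection (right-translation g⁻¹) (left-translation g)
    conjugate-fixes : ∀ t {z} → vmap t z ≡ z → vmap (g ∘ₐ t ∘ₐ g⁻¹) (vmap g z) ≡ vmap g z
    conjugate-fixes t {z} tz≡z =
      cong (vmap g) (≡.trans (cong (vmap t) (proj₁ (inverseˡ g p) z)) tz≡z)
    into : ∀ t → Stab₂ x y t → Stab₂ (vmap g x) (vmap g y) (g ∘ₐ t ∘ₐ g⁻¹)
    into t ((tΓ , tx≡x) , ty≡y) =
      (∘ₐ-∈Γ g (t ∘ₐ g⁻¹) p (∘ₐ-∈Γ t g⁻¹ tΓ (inverse-∈Γ g p)) , conjugate-fixes t tx≡x)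
      , conjugate-fixes t ty≡y
    onto : ∀ s → Stab₂ (vmap g x) (vmap g y) s → ∃ λ t → Stab₂ x y t × g ∘ₐ t ∘ₐ g⁻¹ ≈ s
    onto s ((sΓ , s-fixes-gx) , s-fixes-gy) = g⁻¹ ∘ₐ s ∘ₐ g
      , ((∘ₐ-∈Γ g⁻¹ (s ∘ₐ g) (inverse-∈Γ g p) (∘ₐ-∈Γ s g sΓ p)
         , inverse-maps-back g p (≡.sym s-fixes-gx))
        , inverse-maps-back g p (≡.sym s-fixes-gy))
      , (λ z → ≡.trans (proj₁ (inverseʳ g p) _) (cong (vmap s) (proj₁ (inverseʳ g p) z)))
      , (λ e → ≡.trans (proj₂ (inverseʳ g p) _) (cong (emap s) (proj₂ (inverseʳ g p) e)))

  module Neighbours (α : Aut G) (αΓ : _∈Γ Γ α) (u : Fin nV)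
                    (e₀ : Fin nE) (e₀-joins : Joins G e₀ u (vmap α u)) where

    α⁻¹ : Aut G
    α⁻¹ = inverse α αΓ

    base : Fin 2 → Fin nV
    base zero       = vmap α u
    base (suc zero) = vmap α⁻¹ u

    Nbr : Fin nV → Set
    Nbr = NbrGuα Γ u α

    orbit⇒Nbr : ∀ i {v} → Orbit u (base i) v → Nbr v
    orbit⇒Nbr zero (g , (gΓ , gu≡u) , gαu≡v) =
      emap g e₀ , (g , idₐ , gΓ , Stab-id , J) , subst₂ (Joins G (emap g e₀)) gu≡u gαu≡v J
      where
      J = joins-map g e₀-joins
    orbit⇒Nbr (suc zero) (g , (gΓ , gu≡u) , gα⁻¹u≡v) =
      emap γ e₀ , (γ , idₐ , ∘ₐ-∈Γ g α⁻¹ gΓ (inverse-∈Γ α αΓ) , Stab-id , J)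
      , joins-sym (subst₂ (Joins G (emap γ e₀)) gα⁻¹u≡v γαu≡u J)
      where
      γ = g ∘ₐ α⁻¹
      J = joins-map γ e₀-joins
      γαu≡u : vmap γ (vmap α u) ≡ u
      γαu≡u = ≡.trans (cong (vmap g) (proj₁ (inverseˡ α αΓ) u)) gu≡u

    Nbr⇒orbit : ∀ {v} → Nbr v → ∃ λ i → Orbit u (base i) v
    Nbr⇒orbit (e , (γ , β , γΓ , (βΓ , βu≡u) , J) , J′) with joins-endpoints J J′
    ... | inj₁ (γu≡u , γβαu≡v) =
      zero , γ ∘ₐ β , (∘ₐ-∈Γ γ β γΓ βΓ , ≡.trans (cong (vmap γ) βu≡u) γu≡u) , γβαu≡v
    ... | inj₂ (γu≡v , γβαu≡u) =
      suc zero , γ ∘ₐ β ∘ₐ α , (∘ₐ-∈Γ γ (β ∘ₐ α) γΓ (∘ₐ-∈Γ β α βΓ αΓ) , γβαu≡u)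
      , ≡.trans (cong (vmap (γ ∘ₐ β)) (proj₁ (inverseʳ α αΓ) u)) (≡.trans (cong (vmap γ) βu≡u) γu≡v)

    orbit-α⁻¹u⊆orbit-αu : InvInDoubleCoset Γ u α
      → ∀ {v} → Orbit u (base (suc zero)) v → Orbit u (base zero) v
    orbit-α⁻¹u⊆orbit-αu (β₁ , β₂ , s₁ , (_ , β₂u≡u) , β₁αβ₂α≗id , _) (g , sg , gα⁻¹u≡v) =
      g ∘ₐ β₁ , Stab-∘ g β₁ sg s₁ , ≡.trans (cong (vmap g) β₁αu≡α⁻¹u) gα⁻¹u≡v
      where
      open ≡.≡-Reasoning
      β₁αu≡α⁻¹u : vmap β₁ (vmap α u) ≡ vmap α⁻¹ u
      β₁αu≡α⁻¹u = begin
        vmap β₁ (vmap α u)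
          ≡⟨ cong (vmap β₁ ∘ vmap α) (≡.trans (cong (vmap β₂) (proj₁ (inverseʳ α αΓ) u)) β₂u≡u) ⟨
        vmap β₁ (vmap α (vmap β₂ (vmap α (vmap α⁻¹ u))))
          ≡⟨ β₁αβ₂α≗id _ ⟩
        vmap α⁻¹ u
          ∎

    -- If g α u = g′ α⁻¹ u, then s = g′⁻¹ g ∈ Γ_u sends α u to α⁻¹ u, so m = α s α fixes u
    -- and α⁻¹ = m⁻¹ α s.
    orbits-meet⇒InvInDoubleCoset : ∀ {v} → Orbit u (base zero) v → Orbit u (base (suc zero)) v
      → InvInDoubleCoset Γ u α
    orbits-meet⇒InvInDoubleCoset (g , sg , gαu≡v) (g′ , sg′ , g′α⁻¹u≡v) =
      inverse m (proj₁ sm) , s , Stab-inverse m sm , ss , inverseˡ m (proj₁ sm)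
      where
      g′⁻¹ = inverse g′ (proj₁ sg′)
      s = g′⁻¹ ∘ₐ g
      ss : Stab Γ u s
      ss = Stab-∘ g′⁻¹ g (Stab-inverse g′ sg′) sg
      sαu≡α⁻¹u : vmap s (vmap α u) ≡ vmap α⁻¹ u
      sαu≡α⁻¹u = inverse-maps-back g′ (proj₁ sg′) (≡.trans g′α⁻¹u≡v (≡.sym gαu≡v))
      m = α ∘ₐ s ∘ₐ α
      sm : Stab Γ u m
      sm = ∘ₐ-∈Γ α (s ∘ₐ α) αΓ (∘ₐ-∈Γ s α (proj₁ ss) αΓ)
         , ≡.trans (cong (vmap α) sαu≡α⁻¹u) (proj₁ (inverseʳ α αΓ) u)

    orbits-disjoint : ¬ InvInDoubleCoset Γ u α
      → ∀ i j {v} → Orbit u (base i) v → Orbit u (base j) v → i ≡ j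
    orbits-disjoint _    zero       zero       _ _  = refl
    orbits-disjoint _    (suc zero) (suc zero) _ _  = refl
    orbits-disjoint ¬inv zero       (suc zero) o o′ = contradiction (orbits-meet⇒InvInDoubleCoset o o′) ¬inv
    orbits-disjoint ¬inv (suc zero) zero       o o′ = contradiction (orbits-meet⇒InvInDoubleCoset o′ o) ¬inv

    StabCap⇒Stab₂ : ∀ t → StabCap Γ u α t → Stab₂ u (vmap α u) t
    StabCap⇒Stab₂ _ (st , β , (_ , βu≡u) , tα≗αβ , _) = st , ≡.trans (tα≗αβ u) (cong (vmap α) βu≡u)

    Stab₂⇒StabCap : ∀ t → Stab₂ u (vmap α u) t → StabCap Γ u α t
    Stab₂⇒StabCap t (st , tαu≡αu) = st , α⁻¹ ∘ₐ t ∘ₐ α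
      , (∘ₐ-∈Γ α⁻¹ (t ∘ₐ α) (inverse-∈Γ α αΓ) (∘ₐ-∈Γ t α (proj₁ st) αΓ)
        , inverse-maps-back α αΓ (≡.sym tαu≡αu))
      , (λ _ → ≡.sym (proj₁ (inverseʳ α αΓ) _))
      , (λ _ → ≡.sym (proj₂ (inverseʳ α αΓ) _))

    Stab₂-sizes : ∀ {c} → HasSize _≈_ (StabCap Γ u α) c → ∀ i → HasSize _≈_ (Stab₂ u (base i)) c
    Stab₂-sizes cap zero = HasSize-⇔ Aut-setoid StabCap⇒Stab₂ Stab₂⇒StabCap cap
    Stab₂-sizes cap (suc zero) = HasSize-⇔ Aut-setoid Stab₂-sym Stab₂-sym
      (subst (λ z → HasSize _≈_ (Stab₂ (vmap α⁻¹ u) z) _) (proj₁ (inverseˡ α αΓ) u)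
        (Stab₂-conjugate α⁻¹ (inverse-∈Γ α αΓ) (Stab₂-sizes cap zero)))

    Stab-fibred-over-Nbr : ∀ {k c} → InvInDoubleCoset Γ u α → HasSize _≡_ Nbr k
      → HasSize _≈_ (Stab₂ u (vmap α u)) c → HasSize _≈_ (Stab Γ u) (k * c)
    Stab-fibred-over-Nbr {k} {c} inv nbrs stab₂ =
      HasSize-fibres Aut-setoid (λ g → vmap g (vmap α u)) (λ (v , _) → v _)
        (λ g s → orbit⇒Nbr zero (g , s , refl)) nbrs fibre
      where
      fibre : ∀ v → Nbr v → HasSize _≈_ (λ g → Stab Γ u g × vmap g (vmap α u) ≡ v) c
      fibre v n with Nbr⇒orbit n
      ... | zero     , o = orbit-fibre-size o stab₂
      ... | suc zero , o = orbit-fibre-size (orbit-α⁻¹u⊆orbit-αu inv o) stab₂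

    Fin2×Aut : Setoid 0ℓ 0ℓ
    Fin2×Aut = ≡.setoid (Fin 2) ×ₛ Aut-setoid

    Fin2×Stab-fibred-over-Nbr : ∀ {k c} → ¬ InvInDoubleCoset Γ u α → HasSize _≡_ Nbr k
      → (∀ i → HasSize _≈_ (Stab₂ u (base i)) c)
      → HasSize (Setoid._≈_ Fin2×Aut) (λ (_ , g) → ⊤ × Stab Γ u g) (k * c)
    Fin2×Stab-fibred-over-Nbr {k} {c} ¬inv nbrs stab₂ =
      HasSize-fibres Fin2×Aut (λ (i , g) → vmap g (base i)) (λ { (refl , v , _) → v _ })
        (λ (i , g) (_ , s) → orbit⇒Nbr i (g , s , refl)) nbrs fibre
      where
      tag : Fin 2 → Injection Aut-setoid Fin2×Aut
      tag i = record { to = i ,_ ; cong = refl ,_ ; injective = proj₂ }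
      onto : ∀ i {v} → Orbit u (base i) v
        → ∀ p → (⊤ × Stab Γ u (proj₂ p)) × vmap (proj₂ p) (base (proj₁ p)) ≡ v
        → ∃ λ g → (Stab Γ u g × vmap g (base i) ≡ v) × Setoid._≈_ Fin2×Aut (i , g) p
      onto i o (j , g) ((_ , s) , gbj≡v) with refl ← orbits-disjoint ¬inv i j o (g , s , gbj≡v) =
        g , (s , gbj≡v) , refl , (λ _ → refl) , (λ _ → refl)
      fibre : ∀ v → Nbr v
        → HasSize (Setoid._≈_ Fin2×Aut) (λ (i , g) → (⊤ × Stab Γ u g) × vmap g (base i) ≡ v) c
      fibre v n =
        let (i , o) = Nbr⇒orbit n
        in HasSize-map Aut-setoid Fin2×Aut (tag i) (λ _ (s , gbi≡v) → (tt , s) , gbi≡v) (onto i o)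
             (orbit-fibre-size o (stab₂ i))

lemma4p7 : (G : Graph) → Loopless G → (Γ : Subgroup G) → VertexTransitive Γ
    → (u : Fin (Graph.nV G)) → (α : Aut G) → _∈Γ Γ α
    → (∃ λ e → Joins G e u (vmap α u))
    → (k h c : ℕ)
    → HasSize _≡_ (NbrGuα Γ u α) k
    → HasSize (_≈ₐ_ G) (Stab Γ u) h
    → HasSize (_≈ₐ_ G) (StabCap Γ u α) c
    → (InvInDoubleCoset Γ u α → k * c ≡ h)
      × (¬ InvInDoubleCoset Γ u α → k * c ≡ 2 * h)
lemma4p7 G _ Γ _ u α αΓ (e₀ , e₀-joins) k h c nbrs stab stabCap = when-inv , when-not-inv
  where
  open Automorphisms G
  open Neighbours Γ α αΓ u e₀ e₀-joins
  when-inv : InvInDoubleCoset Γ u α → k * c ≡ h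
  when-inv inv = HasSize-unique Aut-setoid
    (Stab-fibred-over-Nbr inv nbrs (Stab₂-sizes stabCap zero)) stab
  when-not-inv : ¬ InvInDoubleCoset Γ u α → k * c ≡ 2 * h
  when-not-inv ¬inv = HasSize-unique Fin2×Aut
    (Fin2×Stab-fibred-over-Nbr ¬inv nbrs (Stab₂-sizes stabCap))
    (HasSize-× Aut-setoid (HasSize-Fin 2) stab)
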